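{- Let $R$ be a finite local ring with Jacobson radical $J$. Then the distant graph of $\mathbb{P}(R)$ is isomorphic to the complement of the disjoint union of $\frac{|R|}{|J|}+1$ copies of the complete graph on $|J|$ vertices.
   Context: Rings are associative with identity. For a ring $R$, $\mathrm{GL}_2(R)$ acts from the right on the left $R$-module $R^2$ of row vectors. The projective line $\mathbb{P}(R)$ is the orbit of $R(1,0)$ under this action; its points are the submodules $R(a,b)$ with $(a,b)$ the first row of some matrix in $\mathrm{GL}_2(R)$. Two such points $R(a,b)$, $R(c,d)$ are distant if $\begin{pmatrix}a&b\\c&d\end{pmatrix}\in\mathrm{GL}_2(R)$. The distant graph of $\mathbb{P}(R)$ has vertex set $\mathbb{P}(R)$ with an edge between two points exactly when they are distant. The complement of a simple graph has the same vertices and an edge between two distinct vertices exactly when they are not adjacent in the original graph. -}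

module Defs where

open import Level using (Level; _⊔_; suc; 0ℓ)
open import Algebra.Bundles using (Ring)
open import Data.Nat using (ℕ)
open import Data.Fin using (Fin)
open import Data.Product using (Σ; ∃; _×_; _,_; proj₁)
open import Relation.Nullary using (¬_)
open import Relation.Binary using (Rel; Setoid)
open import Relation.Binary.PropositionalEquality using (_≡_; _≢_)
import Relation.Binary.PropositionalEquality as ≡
import Relation.Binary.Construct.On as On
open import Function.Bundles using (Inverse)

HasSize : ∀ {a b} → Setoid a b → ℕ → Set (a ⊔ b)
HasSize S n = Inverse S (≡.setoid (Fin n))

record Graph (v e a : Level) : Set (Level.suc (v ⊔ e ⊔ a)) where
  field
    Vertex : Set v
    _≈_    : Rel Vertex e
    Adj    : Rel Vertex a

record GraphIso {v₁ e₁ a₁ v₂ e₂ a₂}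
                (G : Graph v₁ e₁ a₁) (H : Graph v₂ e₂ a₂)
                : Set (v₁ ⊔ e₁ ⊔ a₁ ⊔ v₂ ⊔ e₂ ⊔ a₂) where
  private
    module G = Graph G
    module H = Graph H
  field
    to       : G.Vertex → H.Vertex
    to-cong  : ∀ {x y} → x G.≈ y → to x H.≈ to y
    to-inj   : ∀ {x y} → to x H.≈ to y → x G.≈ y
    to-surj  : ∀ y → ∃ λ x → to x H.≈ y
    adj-to   : ∀ {x y} → G.Adj x y → H.Adj (to x) (to y)
    adj-from : ∀ {x y} → H.Adj (to x) (to y) → G.Adj x y

_≅_ : ∀ {v₁ e₁ a₁ v₂ e₂ a₂} → Graph v₁ e₁ a₁ → Graph v₂ e₂ a₂ → Set _
G ≅ H = GraphIso G H

CompleteGraph : ℕ → Graph 0ℓ 0ℓ 0ℓ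
CompleteGraph n = record
  { Vertex = Fin n ; _≈_ = _≡_ ; Adj = λ x y → x ≢ y }

Copies : ∀ {v a} → ℕ → Graph v 0ℓ a → Graph v v a
Copies k G = record
  { Vertex = Fin k × Graph.Vertex G
  ; _≈_    = _≡_
  ; Adj    = λ { (i , x) (i′ , x′) → i ≡ i′ × Graph.Adj G x x′ }
  }
  where open Graph

Complement : ∀ {v a} → Graph v v a → Graph v v (v ⊔ a)
Complement G = record
  { Vertex = Graph.Vertex G
  ; _≈_    = _≡_
  ; Adj    = λ x y → (x ≢ y) × ¬ Graph.Adj G x y
  }

module RingDefs {c ℓ} (R : Ring c ℓ) where
  open Ring R

  record LeftIdeal : Set (Level.suc (c ⊔ ℓ)) where
    field
      _∈I     : Carrier → Set (c ⊔ ℓ)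
      ∈-resp  : ∀ {x y} → x ≈ y → x ∈I → y ∈I
      0∈      : 0# ∈I
      +-closed : ∀ {x y} → x ∈I → y ∈I → (x + y) ∈I
      *-closedˡ : ∀ r {x} → x ∈I → (r * x) ∈I

  open LeftIdeal public

  _⊆ᴵ_ : LeftIdeal → LeftIdeal → Set (c ⊔ ℓ)
  I ⊆ᴵ K = ∀ x → _∈I I x → _∈I K x

  Proper : LeftIdeal → Set (c ⊔ ℓ)
  Proper I = ¬ _∈I I 1#

  MaximalLeftIdeal : LeftIdeal → Set (Level.suc (c ⊔ ℓ))
  MaximalLeftIdeal M = Proper M × (∀ I → M ⊆ᴵ I → Proper I → I ⊆ᴵ M)

  IsLocal : Set (Level.suc (c ⊔ ℓ))
  IsLocal = Σ LeftIdeal λ M → MaximalLeftIdeal M ×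
              (∀ N → MaximalLeftIdeal N → (N ⊆ᴵ M) × (M ⊆ᴵ N))

  InJacobson : Carrier → Set (Level.suc (c ⊔ ℓ))
  InJacobson x = ∀ M → MaximalLeftIdeal M → _∈I M x

  JacobsonSetoid : Setoid (Level.suc (c ⊔ ℓ)) ℓ
  JacobsonSetoid = On.setoid setoid (proj₁ {B = InJacobson})

  record Mat₂ : Set c where
    constructor mat
    field
      m₁₁ m₁₂ m₂₁ m₂₂ : Carrier

  open Mat₂

  _·_ : Mat₂ → Mat₂ → Mat₂
  A · B = mat (m₁₁ A * m₁₁ B + m₁₂ A * m₂₁ B) (m₁₁ A * m₁₂ B + m₁₂ A * m₂₂ B)
              (m₂₁ A * m₁₁ B + m₂₂ A * m₂₁ B) (m₂₁ A * m₁₂ B + m₂₂ A * m₂₂ B)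

  I₂ : Mat₂
  I₂ = mat 1# 0# 0# 1#

  _≈ᴹ_ : Mat₂ → Mat₂ → Set ℓ
  A ≈ᴹ B = (m₁₁ A ≈ m₁₁ B) × (m₁₂ A ≈ m₁₂ B) × (m₂₁ A ≈ m₂₁ B) × (m₂₂ A ≈ m₂₂ B)

  InGL₂ : Mat₂ → Set (c ⊔ ℓ)
  InGL₂ A = ∃ λ B → ((A · B) ≈ᴹ I₂) × ((B · A) ≈ᴹ I₂)

  Admissible : Carrier × Carrier → Set (c ⊔ ℓ)
  Admissible (a , b) = ∃ λ c′ → ∃ λ d → InGL₂ (mat a b c′ d)

  -- a point R(a,b) of P(R), represented by an admissible pair
  Point : Set (c ⊔ ℓ)
  Point = Σ (Carrier × Carrier) Admissible

  _∈R_ : Carrier × Carrier → Carrier × Carrier → Set (c ⊔ ℓ)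
  (c′ , d) ∈R (a , b) = ∃ λ r → (c′ ≈ r * a) × (d ≈ r * b)

  -- equality of points = equality of the submodules R(a,b) and R(c,d)
  _≈ᴾ_ : Point → Point → Set (c ⊔ ℓ)
  (p , _) ≈ᴾ (q , _) = (q ∈R p) × (p ∈R q)

  Distant : Point → Point → Set (c ⊔ ℓ)
  Distant ((a , b) , _) ((c′ , d) , _) = InGL₂ (mat a b c′ d)

  DistantGraph : Graph (c ⊔ ℓ) (c ⊔ ℓ) (c ⊔ ℓ)
  DistantGraph = record { Vertex = Point ; _≈_ = _≈ᴾ_ ; Adj = Distant }

-- In a finite ring every element without a left inverse lies in a maximal left ideal: extend the
-- ideal Rz greedily through the finitely many elements of R. Hence in a finite local ring the
-- elements without a left inverse form the unique maximal left ideal, which is J, and left inverses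
-- are two-sided. Every point of P(R) is then R(1,β) with β ∈ R or R(α,1) with α ∈ J, for unique
-- β resp. α; R(1,β) and R(1,δ) are distant iff δ - β ∉ J, R(1,β) and R(α,1) are always distant,
-- and no two points R(α,1) are distant. So the non-adjacency classes are the |R|/|J| cosets β + J
-- together with J itself, each of size |J|.
module Submission where

open import Level using (Level; _⊔_; Lift; lift; lower)
import Level
open import Data.Nat using (ℕ; zero; suc)
import Data.Nat as ℕ
import Data.Nat.Properties as ℕ
open import Data.Fin using (Fin; zero; suc)
open import Data.Fin.Properties using (suc-injective; *↔×)
import Data.Fin.Properties as Fin
open import Data.Fin.Permutation using (↔⇒≡)
open import Data.Product using (∃; _×_; _,_; proj₁; proj₂; map₁)
open import Data.Empty using (⊥-elim)
open import Data.Sum using (_⊎_; inj₁; inj₂)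
open import Data.List using (List; []; _∷_; foldl; tabulate)
open import Data.List.Membership.Propositional using () renaming (_∈_ to _∈ˡ_)
open import Data.List.Membership.Propositional.Properties using (∈-tabulate⁺)
open import Data.List.Relation.Unary.Any using (here; there)
open import Function.Base using (_∘_; _on_)
open import Function.Bundles using (Inverse; Equivalence; _⇔_; mk⇔)
import Function.Properties.Inverse as ↔
open import Relation.Nullary using (¬_; Dec; yes; no)
import Relation.Nullary.Decidable as Dec
open import Relation.Unary using (Pred)
import Relation.Unary as U
open import Relation.Binary using (Rel; Setoid; Decidable; IsEquivalence; IsDecEquivalence; _⇒_; _Respects_)
import Relation.Binary.Construct.On as On
open import Relation.Binary.PropositionalEquality using (_≡_; _≢_; cong)
import Relation.Binary.PropositionalEquality as ≡
open import Algebra.Bundles using (Ring)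

open import Defs

record FinQuotient {a ℓ} {A : Set a} (_~_ : Rel A ℓ) : Set (a ⊔ ℓ) where
  field
    classes        : ℕ
    class          : A → Fin classes
    member         : Fin classes → A
    class-member   : ∀ k → class (member k) ≡ k
    class-sound    : ∀ {x y} → class x ≡ class y → x ~ y
    class-complete : ∀ {x y} → x ~ y → class x ≡ class y

module _ {ℓ} {n : ℕ} {_~_ : Rel (Fin (suc n)) ℓ} (~-equiv : IsEquivalence _~_)
         (Q : FinQuotient (_~_ on suc)) where
  private
    module ~ = IsEquivalence ~-equiv
    module Q = FinQuotient Q

  joinZero : ∀ i → zero ~ suc i → FinQuotient _~_
  joinZero i 0~i = record
    { classes        = Q.classes
    ; class          = class
    ; member         = suc ∘ Q.member
    ; class-member   = Q.class-member
    ; class-sound    = sound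
    ; class-complete = complete
    }
    where
    class : Fin (suc n) → Fin Q.classes
    class zero    = Q.class i
    class (suc k) = Q.class k

    sound : ∀ {x y} → class x ≡ class y → x ~ y
    sound {zero}  {zero}  _ = ~.refl
    sound {zero}  {suc y} e = ~.trans 0~i (Q.class-sound e)
    sound {suc x} {zero}  e = ~.trans (Q.class-sound e) (~.sym 0~i)
    sound {suc x} {suc y} e = Q.class-sound e

    complete : ∀ {x y} → x ~ y → class x ≡ class y
    complete {zero}  {zero}  _   = ≡.refl
    complete {zero}  {suc y} 0~y = Q.class-complete (~.trans (~.sym 0~i) 0~y)
    complete {suc x} {zero}  x~0 = Q.class-complete (~.trans x~0 0~i)
    complete {suc x} {suc y} x~y = Q.class-complete x~y

  separateZero : (∀ i → ¬ zero ~ suc i) → FinQuotient _~_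
  separateZero 0≁ = record
    { classes        = suc Q.classes
    ; class          = class
    ; member         = member
    ; class-member   = class-member
    ; class-sound    = sound
    ; class-complete = complete
    }
    where
    class : Fin (suc n) → Fin (suc Q.classes)
    class zero    = zero
    class (suc k) = suc (Q.class k)

    member : Fin (suc Q.classes) → Fin (suc n)
    member zero    = zero
    member (suc k) = suc (Q.member k)

    class-member : ∀ k → class (member k) ≡ k
    class-member zero    = ≡.refl
    class-member (suc k) = cong suc (Q.class-member k)

    sound : ∀ {x y} → class x ≡ class y → x ~ y
    sound {zero}  {zero}  _ = ~.refl
    sound {suc x} {suc y} e = Q.class-sound (suc-injective e)

    complete : ∀ {x y} → x ~ y → class x ≡ class y
    complete {zero}  {zero}  _   = ≡.refl
    complete {zero}  {suc y} 0~y = ⊥-elim (0≁ y 0~y)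
    complete {suc x} {zero}  x~0 = ⊥-elim (0≁ x (~.sym x~0))
    complete {suc x} {suc y} x~y = cong suc (Q.class-complete x~y)

finQuotient : ∀ {ℓ n} {_~_ : Rel (Fin n) ℓ} → IsDecEquivalence _~_ → FinQuotient _~_
finQuotient {n = zero} _ = record
  { classes        = 0
  ; class          = λ ()
  ; member         = λ ()
  ; class-member   = λ ()
  ; class-sound    = λ { {()} }
  ; class-complete = λ { {()} }
  }
finQuotient {n = suc n} {_~_ = _~_} ~-dec = extend (Fin.any? (λ i → zero ≟ suc i))
  where
  open IsDecEquivalence ~-dec using (isEquivalence; _≟_)
  Q : FinQuotient (_~_ on suc)
  Q = finQuotient (On.isDecEquivalence suc ~-dec)
  extend : Dec (∃ λ i → zero ~ suc i) → FinQuotient _~_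
  extend (yes (i , 0~i)) = joinZero isEquivalence Q i 0~i
  extend (no 0≁)         = separateZero isEquivalence Q (λ i 0~i → 0≁ (i , 0~i))

module FiniteSetoid {a ℓ} {S : Setoid a ℓ} {n : ℕ} (size : HasSize S n) where
  open Setoid S
  open Inverse size

  to-injective : ∀ {x y} → to x ≡ to y → x ≈ y
  to-injective {x} {y} e = trans (sym (strictlyInverseʳ x)) (trans (from-cong e) (strictlyInverseʳ y))

  infix 4 _≟_
  _≟_ : Decidable _≈_
  x ≟ y = Dec.map′ to-injective to-cong (to x Fin.≟ to y)

  any? : ∀ {p} {P : Pred Carrier p} → P Respects _≈_ → U.Decidable P → Dec (∃ P)
  any? resp P? = Dec.map′ (λ (i , Pi) → from i , Pi)
                         (λ (x , Px) → to x , resp (sym (strictlyInverseʳ x)) Px)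
                         (Fin.any? (P? ∘ from))

  size-unique : ∀ {k} → HasSize S k → n ≡ k
  size-unique size′ = ↔⇒≡ (↔.trans (↔.sym size) size′)

  quotient : ∀ {r} {_~_ : Rel Carrier r} → IsDecEquivalence _~_ → _≈_ ⇒ _~_ → FinQuotient _~_
  quotient {_~_ = _~_} ~-dec ≈⇒~ = record
    { classes        = Q.classes
    ; class          = Q.class ∘ to
    ; member         = from ∘ Q.member
    ; class-member   = λ k → ≡.trans (cong Q.class (strictlyInverseˡ (Q.member k))) (Q.class-member k)
    ; class-sound    = λ {x} {y} e → ~.trans (≈⇒~ (sym (strictlyInverseʳ x)))
                                       (~.trans (Q.class-sound e) (≈⇒~ (strictlyInverseʳ y)))
    ; class-complete = λ {x} {y} x~y → Q.class-complete (~.trans (≈⇒~ (strictlyInverseʳ x))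
                                         (~.trans x~y (≈⇒~ (sym (strictlyInverseʳ y)))))
    }
    where
    module ~ = IsDecEquivalence ~-dec
    Q : FinQuotient (_~_ on from)
    Q = finQuotient (On.isDecEquivalence from ~-dec)
    module Q = FinQuotient Q

adjacent⇔differentCopies : ∀ {k j} {x y : Fin k × Fin j} →
                           Graph.Adj (Complement (Copies k (CompleteGraph j))) x y ⇔ (proj₁ x ≢ proj₁ y)
adjacent⇔differentCopies {x = i , t} {i′ , t′} = mk⇔ differentCopies adjacent
  where
  differentCopies : (i , t) ≢ (i′ , t′) × ¬ (i ≡ i′ × t ≢ t′) → i ≢ i′
  differentCopies (x≢y , ¬sameCopy) i≡i′ with t Fin.≟ t′
  ... | yes t≡t′ = x≢y (≡.cong₂ _,_ i≡i′ t≡t′)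
  ... | no  t≢t′ = ¬sameCopy (i≡i′ , t≢t′)

  adjacent : i ≢ i′ → (i , t) ≢ (i′ , t′) × ¬ (i ≡ i′ × t ≢ t′)
  adjacent i≢i′ = (λ x≡y → i≢i′ (cong proj₁ x≡y)) , (λ (i≡i′ , _) → i≢i′ i≡i′)

module RingArithmetic {c ℓ} (R : Ring c ℓ) where
  open Ring R
  open import Algebra.Properties.Ring R using (x[y-z]≈xy-xz)
  open import Algebra.Properties.AbelianGroup +-abelianGroup using (⁻¹-∙-comm; ε⁻¹≈ε)
  open import Algebra.Properties.CommutativeSemigroup +-commutativeSemigroup using (interchange)
  open import Relation.Binary.Reasoning.Setoid setoid

  LeftInvertible : Carrier → Set (c ⊔ ℓ)
  LeftInvertible x = ∃ λ u → u * x ≈ 1#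

  Invertible : Carrier → Set (c ⊔ ℓ)
  Invertible x = ∃ λ u → (x * u ≈ 1#) × (u * x ≈ 1#)

  xu≈1⇒x[uy]≈y : ∀ {x u} → x * u ≈ 1# → ∀ y → x * (u * y) ≈ y
  xu≈1⇒x[uy]≈y {x} {u} xu≈1 y = trans (sym (*-assoc x u y)) (trans (*-congʳ xu≈1) (*-identityˡ y))

  0+-cong : ∀ {x y z} → x ≈ 0# → y ≈ z → x + y ≈ z
  0+-cong {z = z} x≈0 y≈z = trans (+-cong x≈0 y≈z) (+-identityˡ z)

  +0-cong : ∀ {x y z} → x ≈ z → y ≈ 0# → x + y ≈ z
  +0-cong {z = z} x≈z y≈0 = trans (+-cong x≈z y≈0) (+-identityʳ z)

  x-0≈x : ∀ x → x - 0# ≈ x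
  x-0≈x x = trans (+-congˡ ε⁻¹≈ε) (+-identityʳ x)

  x-y+y≈x : ∀ x y → (x - y) + y ≈ x
  x-y+y≈x x y = begin
    (x - y) + y    ≈⟨ +-assoc x (- y) y ⟩
    x + (- y + y)  ≈⟨ +-congˡ (-‿inverseˡ y) ⟩
    x + 0#         ≈⟨ +-identityʳ x ⟩
    x              ∎

  x+y-x≈y : ∀ x y → (x + y) - x ≈ y
  x+y-x≈y x y = begin
    (x + y) - x    ≈⟨ +-congʳ (+-comm x y) ⟩
    (y + x) - x    ≈⟨ +-assoc y x (- x) ⟩
    y + (x - x)    ≈⟨ +-congˡ (-‿inverseʳ x) ⟩
    y + 0#         ≈⟨ +-identityʳ y ⟩
    y              ∎

  x+[y-x]≈y : ∀ x y → x + (y - x) ≈ y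
  x+[y-x]≈y x y = trans (+-comm x (y - x)) (x-y+y≈x y x)

  x-y+[y-z]≈x-z : ∀ x y z → (x - y) + (y - z) ≈ x - z
  x-y+[y-z]≈x-z x y z = begin
    (x - y) + (y - z)    ≈⟨ +-assoc x (- y) (y - z) ⟩
    x + (- y + (y - z))  ≈⟨ +-congˡ (+-assoc (- y) y (- z)) ⟨
    x + ((- y + y) - z)  ≈⟨ +-congˡ (+-congʳ (-‿inverseˡ y)) ⟩
    x + (0# - z)         ≈⟨ +-congˡ (+-identityˡ (- z)) ⟩
    x - z                ∎

  [x+y]-[r+s]e≈[x-re]+[y-se] : ∀ x y r s e → (x + y) - (r + s) * e ≈ (x - r * e) + (y - s * e)
  [x+y]-[r+s]e≈[x-re]+[y-se] x y r s e = begin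
    (x + y) - (r + s) * e          ≈⟨ +-congˡ (-‿cong (distribʳ e r s)) ⟩
    (x + y) - (r * e + s * e)      ≈⟨ +-congˡ (⁻¹-∙-comm (r * e) (s * e)) ⟨
    (x + y) + (- (r * e) - s * e)  ≈⟨ interchange x y (- (r * e)) (- (s * e)) ⟩
    (x - r * e) + (y - s * e)      ∎

  t[x-re]≈tx-[tr]e : ∀ t x r e → t * (x - r * e) ≈ t * x - (t * r) * e
  t[x-re]≈tx-[tr]e t x r e = begin
    t * (x - r * e)      ≈⟨ x[y-z]≈xy-xz t x (r * e) ⟩
    t * x - t * (r * e)  ≈⟨ +-congˡ (-‿cong (*-assoc t r e)) ⟨
    t * x - (t * r) * e  ∎

module Matrices {c ℓ} (R : Ring c ℓ) where
  open Ring R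
  open RingDefs R
  open Mat₂
  open RingArithmetic R
  open import Relation.Binary.Reasoning.Setoid setoid

  ≈ᴹ-refl : ∀ {A} → A ≈ᴹ A
  ≈ᴹ-refl = refl , refl , refl , refl

  ≈ᴹ-sym : ∀ {A B} → A ≈ᴹ B → B ≈ᴹ A
  ≈ᴹ-sym (e₁ , e₂ , e₃ , e₄) = sym e₁ , sym e₂ , sym e₃ , sym e₄

  ≈ᴹ-trans : ∀ {A B C} → A ≈ᴹ B → B ≈ᴹ C → A ≈ᴹ C
  ≈ᴹ-trans (e₁ , e₂ , e₃ , e₄) (f₁ , f₂ , f₃ , f₄) =
    trans e₁ f₁ , trans e₂ f₂ , trans e₃ f₃ , trans e₄ f₄

  ·-cong : ∀ {A A′ B B′} → A ≈ᴹ A′ → B ≈ᴹ B′ → (A · B) ≈ᴹ (A′ · B′)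
  ·-cong (a₁ , a₂ , a₃ , a₄) (b₁ , b₂ , b₃ , b₄) =
    +-cong (*-cong a₁ b₁) (*-cong a₂ b₃) , +-cong (*-cong a₁ b₂) (*-cong a₂ b₄) ,
    +-cong (*-cong a₃ b₁) (*-cong a₄ b₃) , +-cong (*-cong a₃ b₂) (*-cong a₄ b₄)

  private
    entry-assoc : ∀ p q r s t q′ s′ t′ →
      (p * q + r * s) * t + (p * q′ + r * s′) * t′ ≈ p * (q * t + q′ * t′) + r * (s * t + s′ * t′)
    entry-assoc p q r s t q′ s′ t′ = begin
      (p * q + r * s) * t + (p * q′ + r * s′) * t′
        ≈⟨ +-cong (distribʳ t (p * q) (r * s)) (distribʳ t′ (p * q′) (r * s′)) ⟩
      ((p * q) * t + (r * s) * t) + ((p * q′) * t′ + (r * s′) * t′)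
        ≈⟨ +-cong (+-cong (*-assoc p q t) (*-assoc r s t)) (+-cong (*-assoc p q′ t′) (*-assoc r s′ t′)) ⟩
      (p * (q * t) + r * (s * t)) + (p * (q′ * t′) + r * (s′ * t′))
        ≈⟨ interchange _ _ _ _ ⟩
      (p * (q * t) + p * (q′ * t′)) + (r * (s * t) + r * (s′ * t′))
        ≈⟨ +-cong (distribˡ p (q * t) (q′ * t′)) (distribˡ r (s * t) (s′ * t′)) ⟨
      p * (q * t + q′ * t′) + r * (s * t + s′ * t′) ∎
      where open import Algebra.Properties.CommutativeSemigroup +-commutativeSemigroup using (interchange)

  ·-assoc : ∀ A B C → ((A · B) · C) ≈ᴹ (A · (B · C))
  ·-assoc (mat a₁ a₂ a₃ a₄) (mat b₁ b₂ b₃ b₄) (mat c₁ c₂ c₃ c₄) =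
    entry-assoc a₁ b₁ a₂ b₃ c₁ b₂ b₄ c₃ , entry-assoc a₁ b₁ a₂ b₃ c₂ b₂ b₄ c₄ ,
    entry-assoc a₃ b₁ a₄ b₃ c₁ b₂ b₄ c₃ , entry-assoc a₃ b₁ a₄ b₃ c₂ b₂ b₄ c₄

  ·-identityʳ : ∀ A → (A · I₂) ≈ᴹ A
  ·-identityʳ (mat a b c d) =
    +0-cong (*-identityʳ a) (zeroʳ b) , 0+-cong (zeroʳ a) (*-identityʳ b) ,
    +0-cong (*-identityʳ c) (zeroʳ d) , 0+-cong (zeroʳ c) (*-identityʳ d)

  InGL₂-resp : ∀ {A B} → A ≈ᴹ B → InGL₂ A → InGL₂ B
  InGL₂-resp A≈B (C , AC≈I , CA≈I) =
    C , ≈ᴹ-trans (·-cong (≈ᴹ-sym A≈B) ≈ᴹ-refl) AC≈I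
      , ≈ᴹ-trans (·-cong ≈ᴹ-refl (≈ᴹ-sym A≈B)) CA≈I

  private
    cancel-middle : ∀ {A B C} → (B · C) ≈ᴹ I₂ → ((A · B) · C) ≈ᴹ A
    cancel-middle {A} {B} {C} BC≈I =
      ≈ᴹ-trans (·-assoc A B C) (≈ᴹ-trans (·-cong ≈ᴹ-refl BC≈I) (·-identityʳ A))

  InGL₂-· : ∀ {A B} → InGL₂ A → InGL₂ B → InGL₂ (A · B)
  InGL₂-· {A} {B} (A⁻¹ , AA⁻¹ , A⁻¹A) (B⁻¹ , BB⁻¹ , B⁻¹B) =
    B⁻¹ · A⁻¹ ,
    ≈ᴹ-trans (≈ᴹ-sym (·-assoc (A · B) B⁻¹ A⁻¹)) (≈ᴹ-trans (·-cong (cancel-middle BB⁻¹) ≈ᴹ-refl) AA⁻¹)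
    , ≈ᴹ-trans (≈ᴹ-sym (·-assoc (B⁻¹ · A⁻¹) A B)) (≈ᴹ-trans (·-cong (cancel-middle A⁻¹A) ≈ᴹ-refl) B⁻¹B)

  diag : Carrier → Carrier → Mat₂
  diag x y = mat x 0# 0# y

  E₁₂ : Carrier → Mat₂
  E₁₂ β = mat 1# β 0# 1#

  E₂₁ : Carrier → Mat₂
  E₂₁ γ = mat 1# 0# γ 1#

  swap : Mat₂
  swap = mat 0# 1# 1# 0#

  diag-· : ∀ x y p q r s → (diag x y · mat p q r s) ≈ᴹ mat (x * p) (x * q) (y * r) (y * s)
  diag-· x y p q r s =
    +0-cong refl (zeroˡ r) , +0-cong refl (zeroˡ s) , 0+-cong (zeroˡ p) refl , 0+-cong (zeroˡ q) refl

  E₁₂-· : ∀ β p q r s → (E₁₂ β · mat p q r s) ≈ᴹ mat (p + β * r) (q + β * s) r s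
  E₁₂-· β p q r s =
    +-congʳ (*-identityˡ p) , +-congʳ (*-identityˡ q) ,
    0+-cong (zeroˡ p) (*-identityˡ r) , 0+-cong (zeroˡ q) (*-identityˡ s)

  E₂₁-· : ∀ γ p q r s → (E₂₁ γ · mat p q r s) ≈ᴹ mat p q (γ * p + r) (γ * q + s)
  E₂₁-· γ p q r s =
    +0-cong (*-identityˡ p) (zeroˡ r) , +0-cong (*-identityˡ q) (zeroˡ s) ,
    +-congˡ (*-identityˡ r) , +-congˡ (*-identityˡ s)

  swap-· : ∀ p q r s → (swap · mat p q r s) ≈ᴹ mat r s p q
  swap-· p q r s =
    0+-cong (zeroˡ p) (*-identityˡ r) , 0+-cong (zeroˡ q) (*-identityˡ s) ,
    +0-cong (*-identityˡ p) (zeroˡ r) , +0-cong (*-identityˡ q) (zeroˡ s)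

  diag-InGL₂ : ∀ {x y} → Invertible x → Invertible y → InGL₂ (diag x y)
  diag-InGL₂ {x} {y} (x⁻¹ , xx⁻¹ , x⁻¹x) (y⁻¹ , yy⁻¹ , y⁻¹y) =
    diag x⁻¹ y⁻¹ ,
    ≈ᴹ-trans (diag-· x y x⁻¹ 0# 0# y⁻¹) (xx⁻¹ , zeroʳ x , zeroʳ y , yy⁻¹) ,
    ≈ᴹ-trans (diag-· x⁻¹ y⁻¹ x 0# 0# y) (x⁻¹x , zeroʳ x⁻¹ , zeroʳ y⁻¹ , y⁻¹y)

  E₁₂-InGL₂ : ∀ β → InGL₂ (E₁₂ β)
  E₁₂-InGL₂ β =
    E₁₂ (- β) ,
    ≈ᴹ-trans (E₁₂-· β 1# (- β) 0# 1#)
      (+0-cong refl (zeroʳ β) , trans (+-congˡ (*-identityʳ β)) (-‿inverseˡ β) , refl , refl) ,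
    ≈ᴹ-trans (E₁₂-· (- β) 1# β 0# 1#)
      (+0-cong refl (zeroʳ (- β)) , trans (+-congˡ (*-identityʳ (- β))) (-‿inverseʳ β) , refl , refl)

  E₂₁-InGL₂ : ∀ γ → InGL₂ (E₂₁ γ)
  E₂₁-InGL₂ γ =
    E₂₁ (- γ) ,
    ≈ᴹ-trans (E₂₁-· γ 1# 0# (- γ) 1#)
      (refl , refl , trans (+-congʳ (*-identityʳ γ)) (-‿inverseʳ γ) , 0+-cong (zeroʳ γ) refl) ,
    ≈ᴹ-trans (E₂₁-· (- γ) 1# 0# γ 1#)
      (refl , refl , trans (+-congʳ (*-identityʳ (- γ))) (-‿inverseˡ γ) , 0+-cong (zeroʳ (- γ)) refl)

  swap-InGL₂ : InGL₂ swap
  swap-InGL₂ = swap , swap-· 0# 1# 1# 0# , swap-· 0# 1# 1# 0#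

module FiniteRing {c ℓ} (R : Ring c ℓ) {n : ℕ} (size : HasSize (Ring.setoid R) n) where
  open Ring R
  open RingDefs R
  open RingArithmetic R
  open FiniteSetoid size using (any?; _≟_)
  open import Algebra.Properties.AbelianGroup +-abelianGroup using (x∙y⁻¹≈ε⇒x≈y)

  infix 4 _∈_
  _∈_ : Carrier → LeftIdeal → Set (c ⊔ ℓ)
  x ∈ I = _∈I I x

  private
    x-0e≈x : ∀ {e} x → x - 0# * e ≈ x
    x-0e≈x {e} x = trans (+-congˡ (-‿cong (zeroˡ e))) (x-0≈x x)

    _+R_ : LeftIdeal → Carrier → LeftIdeal
    I +R e = record
      { _∈I       = λ x → ∃ λ r → x - r * e ∈ I
      ; ∈-resp    = λ x≈y (r , p) → r , ∈-resp I (+-congʳ x≈y) p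
      ; 0∈        = 0# , ∈-resp I (sym (x-0e≈x 0#)) (0∈ I)
      ; +-closed  = λ {x} {y} (r , p) (s , q) →
                      r + s , ∈-resp I (sym ([x+y]-[r+s]e≈[x-re]+[y-se] x y r s e)) (+-closed I p q)
      ; *-closedˡ = λ t {x} (r , p) → t * r , ∈-resp I (t[x-re]≈tx-[tr]e t x r e) (*-closedˡ I t p)
      }

    ⊆-+R : ∀ I e → I ⊆ᴵ (I +R e)
    ⊆-+R I e x x∈I = 0# , ∈-resp I (sym (x-0e≈x x)) x∈I

    ∈-+R : ∀ I e → e ∈ I +R e
    ∈-+R I e = 1# , ∈-resp I (sym (trans (+-congˡ (-‿cong (*-identityˡ e))) (-‿inverseʳ e))) (0∈ I)

    +R-mono : ∀ I K e → I ⊆ᴵ K → (I +R e) ⊆ᴵ (K +R e)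
    +R-mono I K e I⊆K x (r , p) = r , I⊆K _ p

    record DecLeftIdeal : Set (Level.suc (c ⊔ ℓ)) where
      field
        ideal   : LeftIdeal
        member? : ∀ x → Dec (x ∈ ideal)

    open DecLeftIdeal

    zeroᴰ : DecLeftIdeal
    zeroᴰ = record
      { ideal = record
        { _∈I       = λ x → Lift c (x ≈ 0#)
        ; ∈-resp    = λ x≈y (lift x≈0) → lift (trans (sym x≈y) x≈0)
        ; 0∈        = lift refl
        ; +-closed  = λ (lift x≈0) (lift y≈0) → lift (trans (+-cong x≈0 y≈0) (+-identityʳ 0#))
        ; *-closedˡ = λ r (lift x≈0) → lift (trans (*-congˡ x≈0) (zeroʳ r))
        }
      ; member? = λ x → Dec.map′ lift lower (x ≟ 0#)
      }

    _+ᴰ_ : DecLeftIdeal → Carrier → DecLeftIdeal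
    I +ᴰ e = record
      { ideal   = ideal I +R e
      ; member? = λ x → any? (λ r≈s → ∈-resp (ideal I) (+-congˡ (-‿cong (*-congʳ r≈s))))
                              (λ r → member? I (x - r * e))
      }

    extendIfProper : DecLeftIdeal → Carrier → DecLeftIdeal
    extendIfProper I e with member? (I +ᴰ e) 1#
    ... | yes _ = I
    ... | no  _ = I +ᴰ e

    extendAll : DecLeftIdeal → List Carrier → DecLeftIdeal
    extendAll = foldl extendIfProper

    module _ (I : DecLeftIdeal) (e : Carrier) where

      ⊆-extendIfProper : ideal I ⊆ᴵ ideal (extendIfProper I e)
      ⊆-extendIfProper with member? (I +ᴰ e) 1#
      ... | yes _ = λ _ x∈I → x∈I
      ... | no  _ = ⊆-+R (ideal I) e

      extendIfProper-proper : Proper (ideal I) → Proper (ideal (extendIfProper I e))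
      extendIfProper-proper proper with member? (I +ᴰ e) 1#
      ... | yes _  = proper
      ... | no  1∉ = 1∉

      extendIfProper-decides : e ∈ ideal (extendIfProper I e) ⊎ 1# ∈ ideal I +R e
      extendIfProper-decides with member? (I +ᴰ e) 1#
      ... | yes 1∈ = inj₂ 1∈
      ... | no  _  = inj₁ (∈-+R (ideal I) e)

    ⊆-extendAll : ∀ I es → ideal I ⊆ᴵ ideal (extendAll I es)
    ⊆-extendAll I []       x x∈I = x∈I
    ⊆-extendAll I (e ∷ es) x x∈I = ⊆-extendAll (extendIfProper I e) es x (⊆-extendIfProper I e x x∈I)

    extendAll-proper : ∀ I es → Proper (ideal I) → Proper (ideal (extendAll I es))
    extendAll-proper I []       proper = proper
    extendAll-proper I (e ∷ es) proper =
      extendAll-proper (extendIfProper I e) es (extendIfProper-proper I e proper)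

    extendAll-decides : ∀ I {es e} → e ∈ˡ es →
                        e ∈ ideal (extendAll I es) ⊎ 1# ∈ ideal (extendAll I es) +R e
    extendAll-decides I {e ∷ es} (here ≡.refl) with extendIfProper-decides I e
    ... | inj₁ e∈ = inj₁ (⊆-extendAll (extendIfProper I e) es e e∈)
    ... | inj₂ 1∈ = inj₂ (+R-mono (ideal I) (ideal F) e I⊆F 1# 1∈)
      where
      F : DecLeftIdeal
      F = extendAll (extendIfProper I e) es
      I⊆F : ideal I ⊆ᴵ ideal F
      I⊆F x = ⊆-extendAll (extendIfProper I e) es x ∘ ⊆-extendIfProper I e x
    extendAll-decides I {e′ ∷ es} (there e∈es) = extendAll-decides (extendIfProper I e′) e∈es

    elements : List Carrier
    elements = tabulate (Inverse.from size)

    -- An x ∉ M was rejected when it was tried, so 1 ∈ M + Rx and no proper K ⊇ M contains x.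
    maximal-extendAll : ∀ I → Proper (ideal I) → MaximalLeftIdeal (ideal (extendAll I elements))
    maximal-extendAll I proper = extendAll-proper I elements proper , maximal
      where
      open Inverse size using (to; from; strictlyInverseʳ)
      M : DecLeftIdeal
      M = extendAll I elements
      maximal : ∀ K → ideal M ⊆ᴵ K → Proper K → K ⊆ᴵ ideal M
      maximal K M⊆K K-proper x x∈K with member? M x
      ... | yes x∈M = x∈M
      ... | no x∉M with extendAll-decides I (∈-tabulate⁺ {f = from} (to x))
      ...   | inj₁ x′∈M = ⊥-elim (x∉M (∈-resp (ideal M) (strictlyInverseʳ x) x′∈M))
      ...   | inj₂ (r , 1-rx′∈M) =
        ⊥-elim (K-proper (∈-resp K (x-y+y≈x 1# (r * from (to x)))
          (+-closed K (M⊆K _ 1-rx′∈M) (*-closedˡ K r (∈-resp K (sym (strictlyInverseʳ x)) x∈K)))))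

  ¬leftInvertible⇒∈maximal : ∀ {z} → ¬ LeftInvertible z → ∃ λ M → MaximalLeftIdeal M × z ∈ M
  ¬leftInvertible⇒∈maximal {z} ¬z-invertible =
    ideal M , maximal-extendAll I I-proper , ⊆-extendAll I elements z (∈-+R (ideal zeroᴰ) z)
    where
    I M : DecLeftIdeal
    I = zeroᴰ +ᴰ z
    M = extendAll I elements
    I-proper : Proper (ideal I)
    I-proper (r , lift 1-rz≈0) = ¬z-invertible (r , sym (x∙y⁻¹≈ε⇒x≈y 1# (r * z) 1-rz≈0))

module FiniteLocalRing {c ℓ} (R : Ring c ℓ) {n : ℕ} (size : HasSize (Ring.setoid R) n)
                       (local : RingDefs.IsLocal R) where
  open Ring R
  open RingDefs R
  open RingArithmetic R
  open FiniteRing R size using (_∈_; ¬leftInvertible⇒∈maximal)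
  open FiniteSetoid size using (any?; _≟_)
  open import Algebra.Properties.Ring R using (-1*x≈-x; [y-z]x≈yx-zx)
  open import Relation.Binary.Reasoning.Setoid setoid

  private
    M : LeftIdeal
    M = proj₁ local
    M-maximal : MaximalLeftIdeal M
    M-maximal = proj₁ (proj₂ local)
    M-unique : ∀ N → MaximalLeftIdeal N → (N ⊆ᴵ M) × (M ⊆ᴵ N)
    M-unique = proj₂ (proj₂ local)

  NonUnit : Carrier → Set (c ⊔ ℓ)
  NonUnit x = ¬ LeftInvertible x

  ∈M⇒nonUnit : ∀ {x} → x ∈ M → NonUnit x
  ∈M⇒nonUnit {x} x∈M (u , ux≈1) = proj₁ M-maximal (∈-resp M ux≈1 (*-closedˡ M u x∈M))

  nonUnit⇒∈M : ∀ {x} → NonUnit x → x ∈ M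
  nonUnit⇒∈M x-nonUnit with ¬leftInvertible⇒∈maximal x-nonUnit
  ... | N , N-maximal , x∈N = proj₁ (M-unique N N-maximal) _ x∈N

  nonUnit⇒jacobson : ∀ {x} → NonUnit x → InJacobson x
  nonUnit⇒jacobson x-nonUnit N N-maximal = proj₂ (M-unique N N-maximal) _ (nonUnit⇒∈M x-nonUnit)

  jacobson⇒nonUnit : ∀ {x} → InJacobson x → NonUnit x
  jacobson⇒nonUnit x∈J = ∈M⇒nonUnit (x∈J M M-maximal)

  nonUnit-resp : ∀ {x y} → x ≈ y → NonUnit x → NonUnit y
  nonUnit-resp x≈y x-nonUnit (u , uy≈1) = x-nonUnit (u , trans (*-congˡ x≈y) uy≈1)

  nonUnit-0 : NonUnit 0#
  nonUnit-0 = ∈M⇒nonUnit (0∈ M)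

  nonUnit-+ : ∀ {x y} → NonUnit x → NonUnit y → NonUnit (x + y)
  nonUnit-+ x-nonUnit y-nonUnit = ∈M⇒nonUnit (+-closed M (nonUnit⇒∈M x-nonUnit) (nonUnit⇒∈M y-nonUnit))

  nonUnit-*ˡ : ∀ r {x} → NonUnit x → NonUnit (r * x)
  nonUnit-*ˡ r x-nonUnit = ∈M⇒nonUnit (*-closedˡ M r (nonUnit⇒∈M x-nonUnit))

  nonUnit-‿ : ∀ {x} → NonUnit x → NonUnit (- x)
  nonUnit-‿ {x} x-nonUnit = nonUnit-resp (-1*x≈-x x) (nonUnit-*ˡ (- 1#) x-nonUnit)

  1-leftInvertible : LeftInvertible 1#
  1-leftInvertible = 1# , *-identityˡ 1#

  leftInvertible? : ∀ x → Dec (LeftInvertible x)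
  leftInvertible? x = any? (λ u≈v ux≈1 → trans (*-congʳ (sym u≈v)) ux≈1) (λ u → u * x ≟ 1#)

  ¬nonUnit⇒leftInvertible : ∀ {x} → ¬ NonUnit x → LeftInvertible x
  ¬nonUnit⇒leftInvertible {x} ¬x-nonUnit with leftInvertible? x
  ... | yes x-unit   = x-unit
  ... | no x-nonUnit = ⊥-elim (¬x-nonUnit x-nonUnit)

  nonUnit-sum≉1 : ∀ {x y} → NonUnit x → NonUnit y → ¬ (x + y ≈ 1#)
  nonUnit-sum≉1 x-nonUnit y-nonUnit x+y≈1 =
    nonUnit-resp x+y≈1 (nonUnit-+ x-nonUnit y-nonUnit) 1-leftInvertible

  1-nonUnit-leftInvertible : ∀ {x} → NonUnit x → LeftInvertible (1# - x)
  1-nonUnit-leftInvertible {x} x-nonUnit =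
    ¬nonUnit⇒leftInvertible (λ 1-x-nonUnit → nonUnit-sum≉1 1-x-nonUnit x-nonUnit (x-y+y≈x 1# x))

  -- If x u has a left inverse w then w x is a left inverse of u, hence equal to x; otherwise
  -- 1 - x u has a left inverse v and x = v (1 - x u) x = v (x - x) = 0, contradicting u x ≈ 1.
  leftInverse⇒rightInverse : ∀ {u x} → u * x ≈ 1# → x * u ≈ 1#
  leftInverse⇒rightInverse {u} {x} ux≈1 with leftInvertible? (x * u)
  ... | yes (w , w[xu]≈1) = begin
    x * u        ≈⟨ *-congʳ x≈wx ⟩
    (w * x) * u  ≈⟨ *-assoc w x u ⟩
    w * (x * u)  ≈⟨ w[xu]≈1 ⟩
    1#           ∎
    where
    x≈wx : x ≈ w * x
    x≈wx = begin
      x                  ≈⟨ *-identityˡ x ⟨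
      1# * x             ≈⟨ *-congʳ (trans (sym w[xu]≈1) (sym (*-assoc w x u))) ⟩
      ((w * x) * u) * x  ≈⟨ *-assoc (w * x) u x ⟩
      (w * x) * (u * x)  ≈⟨ *-congˡ ux≈1 ⟩
      (w * x) * 1#       ≈⟨ *-identityʳ (w * x) ⟩
      w * x              ∎
  ... | no xu-nonUnit = ⊥-elim (nonUnit-resp (sym x≈0) nonUnit-0 (u , ux≈1))
    where
    v : Carrier
    v = proj₁ (1-nonUnit-leftInvertible xu-nonUnit)
    v[1-xu]≈1 : v * (1# - x * u) ≈ 1#
    v[1-xu]≈1 = proj₂ (1-nonUnit-leftInvertible xu-nonUnit)
    xux≈x : (x * u) * x ≈ x
    xux≈x = trans (*-assoc x u x) (trans (*-congˡ ux≈1) (*-identityʳ x))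
    x≈0 : x ≈ 0#
    x≈0 = begin
      x                           ≈⟨ *-identityˡ x ⟨
      1# * x                      ≈⟨ *-congʳ v[1-xu]≈1 ⟨
      (v * (1# - x * u)) * x      ≈⟨ *-assoc v (1# - x * u) x ⟩
      v * ((1# - x * u) * x)      ≈⟨ *-congˡ ([y-z]x≈yx-zx x 1# (x * u)) ⟩
      v * (1# * x - (x * u) * x)  ≈⟨ *-congˡ (+-cong (*-identityˡ x) (-‿cong xux≈x)) ⟩
      v * (x - x)                 ≈⟨ *-congˡ (-‿inverseʳ x) ⟩
      v * 0#                      ≈⟨ zeroʳ v ⟩
      0#                          ∎

  leftInvertible⇒invertible : ∀ {x} → LeftInvertible x → Invertible x
  leftInvertible⇒invertible (u , ux≈1) = u , leftInverse⇒rightInverse ux≈1 , ux≈1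

  nonUnit-*ʳ : ∀ {x} → NonUnit x → ∀ y → NonUnit (x * y)
  nonUnit-*ʳ {x} x-nonUnit y (w , w[xy]≈1) =
    x-nonUnit (y * w , trans (*-assoc y w x) (leftInverse⇒rightInverse (trans (*-assoc w x y) w[xy]≈1)))

  leftInverse-unique : ∀ {u v x} → u * x ≈ 1# → v * x ≈ 1# → u ≈ v
  leftInverse-unique {u} {v} {x} ux≈1 vx≈1 = begin
    u             ≈⟨ *-identityʳ u ⟨
    u * 1#        ≈⟨ *-congˡ (leftInverse⇒rightInverse vx≈1) ⟨
    u * (x * v)   ≈⟨ *-assoc u x v ⟨
    (u * x) * v   ≈⟨ *-congʳ ux≈1 ⟩
    1# * v        ≈⟨ *-identityˡ v ⟩
    v             ∎

module LocalGL₂ {c ℓ} (R : Ring c ℓ) {n : ℕ} (size : HasSize (Ring.setoid R) n)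
                (local : RingDefs.IsLocal R) where
  open Ring R
  open RingDefs R
  open Mat₂
  open RingArithmetic R
  open Matrices R
  open FiniteLocalRing R size local
  open import Algebra.Properties.Ring R using (x[y-z]≈xy-xz; -‿involutive)
  open import Algebra.Properties.AbelianGroup +-abelianGroup using (inverseʳ-unique)
  open import Relation.Binary.Reasoning.Setoid setoid

  unitDiag-InGL₂ : ∀ {x y} → LeftInvertible x → LeftInvertible y → InGL₂ (diag x y)
  unitDiag-InGL₂ x-unit y-unit = diag-InGL₂ (leftInvertible⇒invertible x-unit) (leftInvertible⇒invertible y-unit)

  nonUnitColumn⇒¬InGL₂ : ∀ {a b c d} → NonUnit a → NonUnit c → ¬ InGL₂ (mat a b c d)
  nonUnitColumn⇒¬InGL₂ a-nonUnit c-nonUnit (mat e f g h , _ , ea+fc≈1 , _) =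
    nonUnit-sum≉1 (nonUnit-*ˡ e a-nonUnit) (nonUnit-*ˡ f c-nonUnit) ea+fc≈1

  admissible-nonUnit⇒leftInvertible : ∀ {a b} → Admissible (a , b) → NonUnit a → LeftInvertible b
  admissible-nonUnit⇒leftInvertible (_ , _ , mat e f g h , (ae+bg≈1 , _) , _) a-nonUnit =
    ¬nonUnit⇒leftInvertible λ b-nonUnit →
      nonUnit-sum≉1 (nonUnit-*ʳ a-nonUnit e) (nonUnit-*ʳ b-nonUnit g) ae+bg≈1

  module _ {a b c d u u′ : Carrier} (ua≈1 : u * a ≈ 1#) (u′c≈1 : u′ * c ≈ 1#) where
    private
      β δ : Carrier
      β = u * b
      δ = u′ * d

    unitColumn⇒InGL₂ : LeftInvertible (δ - β) → InGL₂ (mat a b c d)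
    unitColumn⇒InGL₂ δ-β-unit = InGL₂-resp factorisation
      (InGL₂-· (unitDiag-InGL₂ (u , ua≈1) (u′ , u′c≈1))
        (InGL₂-· (E₂₁-InGL₂ 1#) (InGL₂-· (unitDiag-InGL₂ 1-leftInvertible δ-β-unit) (E₁₂-InGL₂ β))))
      where
      w : Carrier
      w = δ - β
      [1β0w] : (diag 1# w · E₁₂ β) ≈ᴹ mat 1# β 0# w
      [1β0w] = ≈ᴹ-trans (diag-· 1# w 1# β 0# 1#) (*-identityˡ 1# , *-identityˡ β , zeroʳ w , *-identityʳ w)
      [1β1δ] : (E₂₁ 1# · mat 1# β 0# w) ≈ᴹ mat 1# β 1# δ
      [1β1δ] = ≈ᴹ-trans (E₂₁-· 1# 1# β 0# w)
                 (refl , refl , +0-cong (*-identityˡ 1#) refl , trans (+-congʳ (*-identityˡ β)) (x+[y-x]≈y β δ))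
      [abcd] : (diag a c · mat 1# β 1# δ) ≈ᴹ mat a b c d
      [abcd] = ≈ᴹ-trans (diag-· a c 1# β 1# δ)
                 ( *-identityʳ a , xu≈1⇒x[uy]≈y (leftInverse⇒rightInverse ua≈1) b
                 , *-identityʳ c , xu≈1⇒x[uy]≈y (leftInverse⇒rightInverse u′c≈1) d )
      factorisation : (diag a c · (E₂₁ 1# · (diag 1# w · E₁₂ β))) ≈ᴹ mat a b c d
      factorisation = ≈ᴹ-trans (·-cong ≈ᴹ-refl (≈ᴹ-trans (·-cong ≈ᴹ-refl [1β0w]) [1β1δ])) [abcd]

    InGL₂⇒unitDifference : InGL₂ (mat a b c d) → LeftInvertible (δ - β)
    InGL₂⇒unitDifference (mat e f g h , _ , _ , _ , ga+hc≈0 , gb+hd≈1) = h * c , (begin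
      (h * c) * (δ - β)              ≈⟨ x[y-z]≈xy-xz (h * c) δ β ⟩
      (h * c) * δ - (h * c) * β      ≈⟨ +-cong hcδ≈hd (-‿cong hcβ≈-gb) ⟩
      h * d - - (g * b)              ≈⟨ +-congˡ (-‿involutive (g * b)) ⟩
      h * d + g * b                  ≈⟨ +-comm (h * d) (g * b) ⟩
      g * b + h * d                  ≈⟨ gb+hd≈1 ⟩
      1#                             ∎)
      where
      hcδ≈hd : (h * c) * δ ≈ h * d
      hcδ≈hd = trans (*-assoc h c δ) (*-congˡ (xu≈1⇒x[uy]≈y (leftInverse⇒rightInverse u′c≈1) d))
      gaβ+hcβ≈0 : (g * a) * β + (h * c) * β ≈ 0#
      gaβ+hcβ≈0 = trans (sym (distribʳ β (g * a) (h * c))) (trans (*-congʳ ga+hc≈0) (zeroˡ β))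
      gaβ≈gb : (g * a) * β ≈ g * b
      gaβ≈gb = trans (*-assoc g a β) (*-congˡ (xu≈1⇒x[uy]≈y (leftInverse⇒rightInverse ua≈1) b))
      hcβ≈-gb : (h * c) * β ≈ - (g * b)
      hcβ≈-gb = trans (inverseʳ-unique _ _ gaβ+hcβ≈0) (-‿cong gaβ≈gb)

  unit-nonUnit⇒InGL₂ : ∀ {a b c d u v} → u * a ≈ 1# → v * d ≈ 1# → NonUnit c → InGL₂ (mat a b c d)
  unit-nonUnit⇒InGL₂ {a} {b} {c} {d} {u} {v} ua≈1 vd≈1 c-nonUnit =
    InGL₂-resp factorisation
      (InGL₂-· (unitDiag-InGL₂ (u , ua≈1) (v , vd≈1))
        (InGL₂-· (E₁₂-InGL₂ β) (InGL₂-· (unitDiag-InGL₂ t-unit 1-leftInvertible) (E₂₁-InGL₂ γ))))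
    where
    β γ t : Carrier
    β = u * b
    γ = v * c
    t = 1# - β * γ
    t-unit : LeftInvertible t
    t-unit = 1-nonUnit-leftInvertible (nonUnit-*ˡ β (nonUnit-*ˡ v c-nonUnit))
    [t0γ1] : (diag t 1# · E₂₁ γ) ≈ᴹ mat t 0# γ 1#
    [t0γ1] = ≈ᴹ-trans (diag-· t 1# 1# 0# γ 1#) (*-identityʳ t , zeroʳ t , *-identityˡ γ , *-identityˡ 1#)
    [1βγ1] : (E₁₂ β · mat t 0# γ 1#) ≈ᴹ mat 1# β γ 1#
    [1βγ1] = ≈ᴹ-trans (E₁₂-· β t 0# γ 1#)
               (x-y+y≈x 1# (β * γ) , 0+-cong refl (*-identityʳ β) , refl , refl)
    [abcd] : (diag a d · mat 1# β γ 1#) ≈ᴹ mat a b c d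
    [abcd] = ≈ᴹ-trans (diag-· a d 1# β γ 1#)
               ( *-identityʳ a , xu≈1⇒x[uy]≈y (leftInverse⇒rightInverse ua≈1) b
               , xu≈1⇒x[uy]≈y (leftInverse⇒rightInverse vd≈1) c , *-identityʳ d )
    factorisation : (diag a d · (E₁₂ β · (diag t 1# · E₂₁ γ))) ≈ᴹ mat a b c d
    factorisation = ≈ᴹ-trans (·-cong ≈ᴹ-refl (≈ᴹ-trans (·-cong ≈ᴹ-refl [t0γ1]) [1βγ1])) [abcd]

  nonUnit-unit⇒InGL₂ : ∀ {a b c d u v} → NonUnit a → v * b ≈ 1# → u * c ≈ 1# → InGL₂ (mat a b c d)
  nonUnit-unit⇒InGL₂ {a} {b} {c} {d} a-nonUnit vb≈1 uc≈1 =
    InGL₂-resp (swap-· c d a b) (InGL₂-· swap-InGL₂ (unit-nonUnit⇒InGL₂ uc≈1 vb≈1 a-nonUnit))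

module JacobsonDecomposition {c ℓ} (R : Ring c ℓ) {n : ℕ} (size : HasSize (Ring.setoid R) n)
                             (local : RingDefs.IsLocal R)
                             {j : ℕ} (sizeJ : HasSize (RingDefs.JacobsonSetoid R) j) where
  open Ring R
  open RingDefs R
  open RingArithmetic R
  open FiniteLocalRing R size local
  open import Algebra.Properties.AbelianGroup +-abelianGroup using (x≈y⇒x∙y⁻¹≈ε; ⁻¹-anti-homo‿-)

  _∼_ : Rel Carrier (c ⊔ ℓ)
  x ∼ y = NonUnit (x - y)

  ≈⇒∼ : _≈_ ⇒ _∼_
  ≈⇒∼ x≈y = nonUnit-resp (sym (x≈y⇒x∙y⁻¹≈ε x≈y)) nonUnit-0

  ∼-isDecEquivalence : IsDecEquivalence _∼_
  ∼-isDecEquivalence = record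
    { isEquivalence = record
      { refl  = ≈⇒∼ refl
      ; sym   = λ {x} {y} x∼y → nonUnit-resp (⁻¹-anti-homo‿- x y) (nonUnit-‿ x∼y)
      ; trans = λ {x} {y} {z} x∼y y∼z → nonUnit-resp (x-y+[y-z]≈x-z x y z) (nonUnit-+ x∼y y∼z)
      }
    ; _≟_ = λ x y → Dec.¬? (leftInvertible? (x - y))
    }

  module ∼ = IsDecEquivalence ∼-isDecEquivalence

  residues : FinQuotient _∼_
  residues = FiniteSetoid.quotient size ∼-isDecEquivalence ≈⇒∼

  open FinQuotient residues public
    renaming ( classes to #residues ; class to residue ; member to representative
             ; class-member to residue-representative ; class-sound to residue-sound
             ; class-complete to residue-complete )

  private
    module J = Inverse sizeJ

  jIndex : ∀ x → NonUnit x → Fin j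
  jIndex x x-nonUnit = J.to (x , nonUnit⇒jacobson x-nonUnit)

  jIndex-cong : ∀ {x y} p q → x ≈ y → jIndex x p ≡ jIndex y q
  jIndex-cong _ _ = J.to-cong

  jIndex-injective : ∀ {x y} p q → jIndex x p ≡ jIndex y q → x ≈ y
  jIndex-injective {x} {y} _ _ e =
    trans (sym (J.strictlyInverseʳ (x , _))) (trans (J.from-cong e) (J.strictlyInverseʳ (y , _)))

  fromJ : Fin j → Carrier
  fromJ t = proj₁ (J.from t)

  fromJ-nonUnit : ∀ t → NonUnit (fromJ t)
  fromJ-nonUnit t = jacobson⇒nonUnit (proj₂ (J.from t))

  jIndex-fromJ : ∀ t → jIndex (fromJ t) (fromJ-nonUnit t) ≡ t
  jIndex-fromJ t = ≡.trans (J.to-cong refl) (J.strictlyInverseˡ t)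

  offset-nonUnit : ∀ x → NonUnit (x - representative (residue x))
  offset-nonUnit x = ∼.sym (residue-sound (residue-representative (residue x)))

  offset : Carrier → Fin j
  offset x = jIndex (x - representative (residue x)) (offset-nonUnit x)

  offset-cong : ∀ {x y} → x ≈ y → offset x ≡ offset y
  offset-cong {x} {y} x≈y = jIndex-cong (offset-nonUnit x) (offset-nonUnit y)
    (+-cong x≈y (-‿cong (reflexive (cong representative (residue-complete (≈⇒∼ x≈y))))))

  compose : Fin #residues × Fin j → Carrier
  compose (k , t) = representative k + fromJ t

  decompose : Carrier → Fin #residues × Fin j
  decompose x = residue x , offset x

  decompose-cong : ∀ {x y} → x ≈ y → decompose x ≡ decompose y
  decompose-cong x≈y = ≡.cong₂ _,_ (residue-complete (≈⇒∼ x≈y)) (offset-cong x≈y)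

  compose-cong : ∀ {p q} → p ≡ q → compose p ≈ compose q
  compose-cong ≡.refl = refl

  compose-decompose : ∀ x → compose (decompose x) ≈ x
  compose-decompose x = trans (+-congˡ (J.strictlyInverseʳ (_ , _))) (x+[y-x]≈y (representative (residue x)) x)

  decompose-compose : ∀ p → decompose (compose p) ≡ p
  decompose-compose (k , t) = ≡.cong₂ _,_ residue≡k offset≡t
    where
    r : Carrier
    r = representative k
    [r+t]-r≈t : (r + fromJ t) - r ≈ fromJ t
    [r+t]-r≈t = x+y-x≈y r (fromJ t)
    residue≡k : residue (r + fromJ t) ≡ k
    residue≡k = ≡.trans (residue-complete (nonUnit-resp (sym [r+t]-r≈t) (fromJ-nonUnit t)))
                        (residue-representative k)
    offset≡t : offset (r + fromJ t) ≡ t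
    offset≡t = ≡.trans (jIndex-cong (offset-nonUnit (r + fromJ t)) (fromJ-nonUnit t)
                         (trans (+-congˡ (-‿cong (reflexive (cong representative residue≡k)))) [r+t]-r≈t))
                       (jIndex-fromJ t)

  decompose-injective : ∀ {x y} → decompose x ≡ decompose y → x ≈ y
  decompose-injective {x} {y} e =
    trans (sym (compose-decompose x)) (trans (compose-cong e) (compose-decompose y))

  decomposition : Inverse setoid (≡.setoid (Fin #residues × Fin j))
  decomposition = record
    { to        = decompose
    ; from      = compose
    ; to-cong   = decompose-cong
    ; from-cong = compose-cong
    ; inverse   = strictlyInverseˡ⇒inverseˡ decompose-cong decompose-compose
                , strictlyInverseʳ⇒inverseʳ {f = decompose} compose-cong compose-decompose
    }
    where open import Function.Consequences.Setoid setoid (≡.setoid (Fin #residues × Fin j))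

  size≡#residues*j : n ≡ #residues ℕ.* j
  size≡#residues*j = FiniteSetoid.size-unique size (↔.trans decomposition (↔.sym *↔×))

module ProjectiveLine {c ℓ} (R : Ring c ℓ) {n : ℕ} (size : HasSize (Ring.setoid R) n)
                      (local : RingDefs.IsLocal R)
                      {j : ℕ} (sizeJ : HasSize (RingDefs.JacobsonSetoid R) j) where
  open Ring R hiding (zero)
  open RingDefs R
  open Mat₂
  open RingArithmetic R
  open Matrices R
  open FiniteLocalRing R size local
  open LocalGL₂ R size local
  open JacobsonDecomposition R size local sizeJ
  open import Relation.Binary.Reasoning.Setoid setoid

  coordinate-invariant : ∀ {x y x′ y′ r w w′} → w * x ≈ 1# → w′ * x′ ≈ 1# →
                         x′ ≈ r * x → y′ ≈ r * y → w′ * y′ ≈ w * y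
  coordinate-invariant {x} {y} {x′} {y′} {r} {w} {w′} wx≈1 w′x′≈1 x′≈rx y′≈ry = begin
    w′ * y′        ≈⟨ *-congˡ y′≈ry ⟩
    w′ * (r * y)   ≈⟨ *-assoc w′ r y ⟨
    (w′ * r) * y   ≈⟨ *-congʳ (leftInverse-unique w′r-inverse wx≈1) ⟩
    w * y          ∎
    where
    w′r-inverse : (w′ * r) * x ≈ 1#
    w′r-inverse = trans (*-assoc w′ r x) (trans (*-congˡ (sym x′≈rx)) w′x′≈1)

  equal-coordinates⇒∈R : ∀ {x y x′ y′ w w′} → w * x ≈ 1# → w′ * x′ ≈ 1# →
                         w * y ≈ w′ * y′ → (x′ , y′) ∈R (x , y)
  equal-coordinates⇒∈R {x} {y} {x′} {y′} {w} {w′} wx≈1 w′x′≈1 wy≈w′y′ =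
    x′ * w , sym (trans (*-assoc x′ w x) (trans (*-congˡ wx≈1) (*-identityʳ x′))) , sym (begin
      (x′ * w) * y     ≈⟨ *-assoc x′ w y ⟩
      x′ * (w * y)     ≈⟨ *-congˡ wy≈w′y′ ⟩
      x′ * (w′ * y′)   ≈⟨ xu≈1⇒x[uy]≈y (leftInverse⇒rightInverse w′x′≈1) y′ ⟩
      y′               ∎)

  ∈R-swap : ∀ {x y x′ y′} → (x′ , y′) ∈R (x , y) → (y′ , x′) ∈R (y , x)
  ∈R-swap (r , x′≈rx , y′≈ry) = r , y′≈ry , x′≈rx

  data Chart (a b : Carrier) : Set (c ⊔ ℓ) where
    affine     : ∀ u → u * a ≈ 1# → Chart a b
    atInfinity : ∀ v → v * b ≈ 1# → NonUnit a → Chart a b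

  chart : ∀ {a b} → Admissible (a , b) → Chart a b
  chart {a} adm with leftInvertible? a
  ... | yes (u , ua≈1) = affine u ua≈1
  ... | no a-nonUnit   = atInfinity _ (proj₂ (admissible-nonUnit⇒leftInvertible adm a-nonUnit)) a-nonUnit

  Label : Set
  Label = Fin (suc #residues) × Fin j

  -- Copy zero holds the points R(α, 1) with α ∈ J, copy suc k the points R(1, β) with β in the
  -- k-th residue class; the second component locates α, resp. β, inside that coset of J.
  chartLabel : ∀ {a b} → Chart a b → Label
  chartLabel {b = b} (affine u _)               = map₁ suc (decompose (u * b))
  chartLabel {a = a} (atInfinity v _ a-nonUnit) = zero , jIndex (v * a) (nonUnit-*ˡ v a-nonUnit)

  label : Point → Label
  label (_ , adm) = chartLabel (chart adm)

  label-cong : ∀ {p q} → p ≈ᴾ q → label p ≡ label q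
  label-cong {(a , b) , adm} {(a′ , b′) , adm′} ((r , a′≈ra , b′≈rb) , (s , a≈sa′ , b≈sb′))
    with chart adm | chart adm′
  ... | affine u ua≈1 | affine u′ u′a′≈1 =
    cong (map₁ suc) (decompose-cong ub≈u′b′)
    where
    ub≈u′b′ : u * b ≈ u′ * b′
    ub≈u′b′ = sym (coordinate-invariant ua≈1 u′a′≈1 a′≈ra b′≈rb)
  ... | atInfinity v vb≈1 a-nonUnit | atInfinity v′ v′b′≈1 a′-nonUnit =
    cong (zero ,_) (jIndex-cong (nonUnit-*ˡ v a-nonUnit) (nonUnit-*ˡ v′ a′-nonUnit)
      (sym (coordinate-invariant vb≈1 v′b′≈1 b′≈rb a′≈ra)))
  ... | affine u ua≈1 | atInfinity _ _ a′-nonUnit =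
    ⊥-elim (nonUnit-resp (sym a≈sa′) (nonUnit-*ˡ s a′-nonUnit) (u , ua≈1))
  ... | atInfinity _ _ a-nonUnit | affine u′ u′a′≈1 =
    ⊥-elim (nonUnit-resp (sym a′≈ra) (nonUnit-*ˡ r a-nonUnit) (u′ , u′a′≈1))

  label-injective : ∀ {p q} → label p ≡ label q → p ≈ᴾ q
  label-injective {(a , b) , adm} {(a′ , b′) , adm′} label≡
    with chart adm | chart adm′
  ... | affine u ua≈1 | affine u′ u′a′≈1 =
    equal-coordinates⇒∈R ua≈1 u′a′≈1 ub≈u′b′ ,
    equal-coordinates⇒∈R u′a′≈1 ua≈1 (sym ub≈u′b′)
    where
    ub≈u′b′ : u * b ≈ u′ * b′
    ub≈u′b′ = decompose-injective
      (≡.cong₂ _,_ (suc-injective (cong proj₁ label≡)) (cong proj₂ label≡))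
  ... | atInfinity v vb≈1 a-nonUnit | atInfinity v′ v′b′≈1 a′-nonUnit =
    ∈R-swap (equal-coordinates⇒∈R vb≈1 v′b′≈1 va≈v′a′) ,
    ∈R-swap (equal-coordinates⇒∈R v′b′≈1 vb≈1 (sym va≈v′a′))
    where
    va≈v′a′ : v * a ≈ v′ * a′
    va≈v′a′ = jIndex-injective (nonUnit-*ˡ v a-nonUnit) (nonUnit-*ˡ v′ a′-nonUnit) (cong proj₂ label≡)
  ... | affine _ _ | atInfinity _ _ _ with () ← cong proj₁ label≡
  ... | atInfinity _ _ _ | affine _ _ with () ← cong proj₁ label≡

  infinityPoint : Fin j → Point
  infinityPoint t = (fromJ t , 1#) , 1# , 0# ,
    InGL₂-resp (swap-· 1# 0# (fromJ t) 1#) (InGL₂-· swap-InGL₂ (E₂₁-InGL₂ (fromJ t)))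

  affinePoint : Carrier → Point
  affinePoint b = (1# , b) , 0# , 1# , E₁₂-InGL₂ b

  infinityPoint-label : ∀ t (ch : Chart (fromJ t) 1#) → chartLabel ch ≡ (zero , t)
  infinityPoint-label t (affine u ux≈1) = ⊥-elim (fromJ-nonUnit t (u , ux≈1))
  infinityPoint-label t (atInfinity v v1≈1 x-nonUnit) =
    cong (zero ,_) (≡.trans (jIndex-cong (nonUnit-*ˡ v x-nonUnit) (fromJ-nonUnit t) vx≈x) (jIndex-fromJ t))
    where
    vx≈x : v * fromJ t ≈ fromJ t
    vx≈x = trans (*-congʳ (trans (sym (*-identityʳ v)) v1≈1)) (*-identityˡ (fromJ t))

  affinePoint-label : ∀ k t (ch : Chart 1# (compose (k , t))) → chartLabel ch ≡ (suc k , t)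
  affinePoint-label k t (affine u u1≈1) =
    cong (map₁ suc) (≡.trans (decompose-cong ub≈b) (decompose-compose (k , t)))
    where
    ub≈b : u * compose (k , t) ≈ compose (k , t)
    ub≈b = trans (*-congʳ (trans (sym (*-identityʳ u)) u1≈1)) (*-identityˡ _)
  affinePoint-label k t (atInfinity _ _ 1-nonUnit) = ⊥-elim (1-nonUnit 1-leftInvertible)

  label-surjective : ∀ l → ∃ λ p → label p ≡ l
  label-surjective (zero , t)  = infinityPoint t , infinityPoint-label t _
  label-surjective (suc k , t) = affinePoint (compose (k , t)) , affinePoint-label k t _

  distant⇔differentCopies : ∀ {p q} → Distant p q ⇔ (proj₁ (label p) ≢ proj₁ (label q))
  distant⇔differentCopies {(a , b) , adm} {(c′ , d) , adm′} with chart adm | chart adm′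
  ... | affine u ua≈1 | affine u′ u′c≈1 = mk⇔
    (λ distant same →
      ∼.sym (residue-sound (suc-injective same)) (InGL₂⇒unitDifference ua≈1 u′c≈1 distant))
    (λ differ → unitColumn⇒InGL₂ ua≈1 u′c≈1
      (¬nonUnit⇒leftInvertible (λ δ∼β → differ (cong suc (residue-complete (∼.sym δ∼β))))))
  ... | affine u ua≈1 | atInfinity v′ v′d≈1 c-nonUnit =
    mk⇔ (λ _ ()) (λ _ → unit-nonUnit⇒InGL₂ ua≈1 v′d≈1 c-nonUnit)
  ... | atInfinity v vb≈1 a-nonUnit | affine u′ u′c≈1 =
    mk⇔ (λ _ ()) (λ _ → nonUnit-unit⇒InGL₂ a-nonUnit vb≈1 u′c≈1)
  ... | atInfinity _ _ a-nonUnit | atInfinity _ _ c-nonUnit =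
    mk⇔ (λ distant _ → nonUnitColumn⇒¬InGL₂ a-nonUnit c-nonUnit distant)
        (λ differ → ⊥-elim (differ ≡.refl))

  distantGraph≅ : DistantGraph ≅ Complement (Copies (suc #residues) (CompleteGraph j))
  distantGraph≅ = record
    { to       = label
    ; to-cong  = label-cong
    ; to-inj   = label-injective
    ; to-surj  = label-surjective
    ; adj-to   = Equivalence.from adjacent⇔differentCopies ∘ Equivalence.to distant⇔differentCopies
    ; adj-from = Equivalence.from distant⇔differentCopies ∘ Equivalence.to adjacent⇔differentCopies
    }

open import Data.Nat using (_+_; _/_; NonZero)
open import Data.Nat.DivMod using (m*n/n≡m)

proposition3 : ∀ {c ℓ : Level} (R : Ring c ℓ) → RingDefs.IsLocal R →
    (n j : ℕ) → HasSize (Ring.setoid R) n → HasSize (RingDefs.JacobsonSetoid R) j →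
    .{{_ : NonZero j}} →
    RingDefs.DistantGraph R ≅ Complement (Copies (n / j + 1) (CompleteGraph j))
proposition3 R local n j sizeR sizeJ =
  ≡.subst (λ k → RingDefs.DistantGraph R ≅ Complement (Copies k (CompleteGraph j))) #copies distantGraph≅
  where
  open JacobsonDecomposition R sizeR local sizeJ using (#residues; size≡#residues*j)
  open ProjectiveLine R sizeR local sizeJ using (distantGraph≅)
  #copies : suc #residues ≡ n / j + 1
  #copies = begin
    suc #residues            ≡⟨ ℕ.+-comm 1 #residues ⟩
    #residues + 1            ≡⟨ cong (_+ 1) (m*n/n≡m #residues j) ⟨
    #residues ℕ.* j / j + 1  ≡⟨ cong (λ m → m / j + 1) size≡#residues*j ⟨
    n / j + 1                ∎
    where open ≡.≡-Reasoning
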